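{- For every $i\in\{1,3,4,5,6\}$, the class of 3-frames satisfying (B$i$) is not $\mathcal L_\beta$-definable. Moreover, the class of 3-frames satisfying (B8) is not $\mathcal H_\beta(@)$-definable.
   Context: A 3-frame is $\langle W,B\rangle$ with $B\subseteq W^3$; $\#(x,y,z)$ means $x,y,z$ pairwise distinct. The conditions (universally closed): (B1) $B(x,y,z)\to\#(x,y,z)$; (B3) $B(x,y,z)\to\neg B(x,z,y)$; (B4) $B(x,y,z)\wedge B(y,z,u)\to B(x,y,u)$; (B5) $B(x,y,z)\wedge B(y,u,z)\to B(x,y,u)$; (B6) $\#(x,y,z)\to B(x,y,z)\vee B(x,z,y)\vee B(y,x,z)$; (B8) $x\neq z\to\exists y\,B(x,y,z)$. $\mathcal L_\beta$: $\varphi::=\top\mid p\mid\neg\varphi\mid\varphi\wedge\psi\mid\langle B\rangle(\varphi,\psi)$; $\mathcal H_\beta(@)$ additionally has nominals $i$ and $@_i\varphi$. Valuations map variables to subsets and nominals to singletons; $w\Vdash\langle B\rangle(\varphi,\psi)$ iff there are $x,y$ with $x\Vdash\varphi$, $y\Vdash\psi$ and $B(x,w,y)$; $w\Vdash i$ iff $V(i)=\{w\}$; $w\Vdash @_i\varphi$ iff the element of $V(i)$ satisfies $\varphi$. A class $K$ of 3-frames is $\mathcal L$-definable if there is a set $\Phi$ of $\mathcal L$-formulas such that for every 3-frame $\mathfrak F$, $\mathfrak F\in K$ iff all formulas of $\Phi$ are valid on $\mathfrak F$. -}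

module Defs where

open import Level using (Level; suc; _⊔_)
open import Data.Nat using (ℕ)
open import Data.Product using (Σ; ∃; _×_; _,_)
open import Data.Sum using (_⊎_)
open import Data.Unit using (⊤)
open import Relation.Nullary using (¬_)
open import Relation.Binary.PropositionalEquality using (_≡_; _≢_)
open import Function.Bundles using (_⇔_)

record Frame3 : Set₁ where
  field
    W : Set
    B : W → W → W → Set
open Frame3 public

# : {W : Set} → W → W → W → Set
# x y z = (x ≢ y) × (y ≢ z) × (x ≢ z)

B1 : Frame3 → Set
B1 F = ∀ x y z → B F x y z → # x y z

B3 : Frame3 → Set
B3 F = ∀ x y z → B F x y z → ¬ B F x z y

B4 : Frame3 → Set
B4 F = ∀ x y z u → B F x y z → B F y z u → B F x y u

B5 : Frame3 → Set
B5 F = ∀ x y z u → B F x y z → B F y u z → B F x y u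

B6 : Frame3 → Set
B6 F = ∀ x y z → # x y z → B F x y z ⊎ B F x z y ⊎ B F y x z

B8 : Frame3 → Set
B8 F = ∀ x z → x ≢ z → ∃ λ y → B F x y z

data Formβ : Set where
  ⊤'   : Formβ
  var  : ℕ → Formβ
  ¬'_  : Formβ → Formβ
  _∧'_ : Formβ → Formβ → Formβ
  ⟨B⟩  : Formβ → Formβ → Formβ

Valβ : Frame3 → Set₁
Valβ F = ℕ → W F → Set

sat : (F : Frame3) → Valβ F → W F → Formβ → Set
sat F V w ⊤'        = ⊤
sat F V w (var p)   = V p w
sat F V w (¬' φ)    = ¬ sat F V w φ
sat F V w (φ ∧' ψ)  = sat F V w φ × sat F V w ψ
sat F V w (⟨B⟩ φ ψ) = ∃ λ x → ∃ λ y → sat F V x φ × sat F V y ψ × B F x w y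

validβ : Frame3 → Formβ → Set₁
validβ F φ = (V : Valβ F) (w : W F) → sat F V w φ

Definableβ : (Frame3 → Set) → Set₁
Definableβ K = Σ (Formβ → Set) λ Φ →
  (F : Frame3) → K F ⇔ ((φ : Formβ) → Φ φ → validβ F φ)

data FormH : Set where
  ⊤'   : FormH
  var  : ℕ → FormH
  nom  : ℕ → FormH
  ¬'_  : FormH → FormH
  _∧'_ : FormH → FormH → FormH
  ⟨B⟩  : FormH → FormH → FormH
  at   : ℕ → FormH → FormH

-- A hybrid valuation: variables to subsets, nominals to singletons
-- (a singleton {v} is represented by its unique element v).
record ValH (F : Frame3) : Set₁ where
  field
    vars : ℕ → W F → Set
    noms : ℕ → W F
open ValH public

satH : (F : Frame3) → ValH F → W F → FormH → Set
satH F V w ⊤'        = ⊤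
satH F V w (var p)   = vars V p w
satH F V w (nom i)   = noms V i ≡ w
satH F V w (¬' φ)    = ¬ satH F V w φ
satH F V w (φ ∧' ψ)  = satH F V w φ × satH F V w ψ
satH F V w (⟨B⟩ φ ψ) = ∃ λ x → ∃ λ y → satH F V x φ × satH F V y ψ × B F x w y
satH F V w (at i φ)  = satH F V (noms V i) φ

validH : Frame3 → FormH → Set₁
validH F φ = (V : ValH F) (w : W F) → satH F V w φ

DefinableH : (Frame3 → Set) → Set₁
DefinableH K = Σ (FormH → Set) λ Φ →
  (F : Frame3) → K F ⇔ ((φ : FormH) → Φ φ → validH F φ)

{-# OPTIONS --safe #-}
-- Truth of L_β-formulas is invariant under bounded morphisms, so validity on F
-- passes to every frame whose points all lie in bounded-morphic images of F; a
-- definable class is closed under this.  (B1), (B3), (B4), (B5) hold in the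
-- unravelling of a frame in which every point y lies only between l y and r y
-- (there the middle of a triple is a proper subterm of both ends), but fail in
-- such frames on ℕ; (B6) holds on the one-point empty frame, which
-- covers the empty frame on ℕ.  Nominals break invariance under bounded
-- morphisms but not under injective ones, and the empty frame on ℕ, violating
-- (B8), is a generated subframe of the frame that puts one new point between
-- any two distinct points, which satisfies (B8).
module Submission where

open import Defs
open import Data.Product using (_×_; _,_; ∃; proj₁)
open import Relation.Nullary using (¬_)
open import Data.Empty using (⊥; ⊥-elim)
open import Data.Unit using (⊤; tt)
open import Data.Sum using (inj₁; inj₂)
open import Data.Nat using (ℕ; suc; pred)
open import Data.Maybe using (Maybe; just; nothing)
open import Data.Maybe.Properties using (just-injective)
open import Function using (id; const; _∘_)
open import Function.Bundles using (Equivalence)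
open import Function.Definitions using (Injective)
open import Relation.Binary.PropositionalEquality using (_≡_; _≢_; refl; sym; cong; subst)

record BoundedMorphism (F G : Frame3) : Set where
  field
    map   : W F → W G
    forth : ∀ {x w y} → B F x w y → B G (map x) (map w) (map y)
    back  : ∀ {x′ w y′} → B G x′ (map w) y′ →
            ∃ λ x → ∃ λ y → map x ≡ x′ × map y ≡ y′ × B F x w y
open BoundedMorphism

BoundedCover : Frame3 → Frame3 → Set
BoundedCover F G = (w : W G) → ∃ λ (h : BoundedMorphism F G) → ∃ λ v → map h v ≡ w

record GeneratedEmbedding (G F : Frame3) : Set where
  field
    morphism  : BoundedMorphism G F
    injective : Injective _≡_ _≡_ (map morphism)
open GeneratedEmbedding

module _ {F G : Frame3} (h : BoundedMorphism F G) (V : Valβ G) where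

  comap : Valβ F
  comap p = V p ∘ map h

  sat-comap⁺ : ∀ x φ → sat F comap x φ → sat G V (map h x) φ
  sat-comap⁻ : ∀ x φ → sat G V (map h x) φ → sat F comap x φ

  sat-comap⁺ x ⊤'        s               = tt
  sat-comap⁺ x (var p)   s               = s
  sat-comap⁺ x (¬' φ)    s t             = s (sat-comap⁻ x φ t)
  sat-comap⁺ x (φ ∧' ψ)  (s , t)         = sat-comap⁺ x φ s , sat-comap⁺ x ψ t
  sat-comap⁺ x (⟨B⟩ φ ψ) (a , b , s , t , r) =
    map h a , map h b , sat-comap⁺ a φ s , sat-comap⁺ b ψ t , forth h r

  sat-comap⁻ x ⊤'        s               = tt
  sat-comap⁻ x (var p)   s               = s
  sat-comap⁻ x (¬' φ)    s t             = s (sat-comap⁺ x φ t)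
  sat-comap⁻ x (φ ∧' ψ)  (s , t)         = sat-comap⁻ x φ s , sat-comap⁻ x ψ t
  sat-comap⁻ x (⟨B⟩ φ ψ) (_ , _ , s , t , r) with back h r
  ... | a , b , refl , refl , r′ = a , b , sat-comap⁻ a φ s , sat-comap⁻ b ψ t , r′

validβ-cover : ∀ {F G} → BoundedCover F G → ∀ φ → validβ F φ → validβ G φ
validβ-cover cover φ valid V w with cover w
... | h , v , refl = sat-comap⁺ h V v φ (valid (comap h V) v)

¬Definableβ-cover : ∀ {K F G} → K F → ¬ K G → BoundedCover F G → ¬ Definableβ K
¬Definableβ-cover {F = F} {G} KF ¬KG cover (Φ , defines) =
  ¬KG (Equivalence.from (defines G) λ φ φ∈Φ →
    validβ-cover cover φ (Equivalence.to (defines F) KF φ φ∈Φ))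

module _ {G F : Frame3} (e : GeneratedEmbedding G F) (V : ValH G) where

  private
    h = morphism e

  push : ValH F
  vars push p y = ∃ λ w → map h w ≡ y × vars V p w
  noms push i   = map h (noms V i)

  satH-push⁺ : ∀ w φ → satH F push (map h w) φ → satH G V w φ
  satH-push⁻ : ∀ w φ → satH G V w φ → satH F push (map h w) φ

  satH-push⁺ w ⊤'        s               = tt
  satH-push⁺ w (var p)   (_ , eq , s)    = subst (vars V p) (injective e eq) s
  satH-push⁺ w (nom i)   eq              = injective e eq
  satH-push⁺ w (¬' φ)    s t             = s (satH-push⁻ w φ t)
  satH-push⁺ w (φ ∧' ψ)  (s , t)         = satH-push⁺ w φ s , satH-push⁺ w ψ t
  satH-push⁺ w (⟨B⟩ φ ψ) (_ , _ , s , t , r) with back h r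
  ... | a , b , refl , refl , r′ = a , b , satH-push⁺ a φ s , satH-push⁺ b ψ t , r′
  satH-push⁺ w (at i φ)  s               = satH-push⁺ (noms V i) φ s

  satH-push⁻ w ⊤'        s               = tt
  satH-push⁻ w (var p)   s               = w , refl , s
  satH-push⁻ w (nom i)   eq              = cong (map h) eq
  satH-push⁻ w (¬' φ)    s t             = s (satH-push⁺ w φ t)
  satH-push⁻ w (φ ∧' ψ)  (s , t)         = satH-push⁻ w φ s , satH-push⁻ w ψ t
  satH-push⁻ w (⟨B⟩ φ ψ) (a , b , s , t , r) =
    map h a , map h b , satH-push⁻ a φ s , satH-push⁻ b ψ t , forth h r
  satH-push⁻ w (at i φ)  s               = satH-push⁻ (noms V i) φ s

validH-embedding : ∀ {G F} → GeneratedEmbedding G F → ∀ φ → validH F φ → validH G φ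
validH-embedding e φ valid V w = satH-push⁺ e V w φ (valid (push e V) (map (morphism e) w))

¬DefinableH-embedding : ∀ {K G F} → K F → ¬ K G → GeneratedEmbedding G F → ¬ DefinableH K
¬DefinableH-embedding {G = G} {F} KF ¬KG e (Φ , defines) =
  ¬KG (Equivalence.from (defines G) λ φ φ∈Φ →
    validH-embedding e φ (Equivalence.to (defines F) KF φ φ∈Φ))

functionFrame : (A : Set) → (A → A) → (A → A) → Frame3
functionFrame A l r = record { W = A ; B = λ x y z → x ≡ l y × z ≡ r y }

data Tree (A : Set) : Set where
  leaf        : A → Tree A
  left right  : Tree A → Tree A

data Branch {A : Set} : Tree A → Tree A → Tree A → Set where
  branch : ∀ t → Branch (left t) t (right t)

unravel : Set → Frame3
unravel A = record { W = Tree A ; B = Branch }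

unravel-B1 : ∀ A → B1 (unravel A)
unravel-B1 A _ _ _ (branch t) = (λ ()) , (λ ()) , (λ ())

unravel-B3 : ∀ A → B3 (unravel A)
unravel-B3 A _ _ _ (branch t) ()

unravel-B4 : ∀ A → B4 (unravel A)
unravel-B4 A _ _ _ _ (branch t) ()

unravel-B5 : ∀ A → B5 (unravel A)
unravel-B5 A _ _ _ _ (branch t) ()

fold : ∀ {A} → (A → A) → (A → A) → Tree A → A
fold l r (leaf a)  = a
fold l r (left t)  = l (fold l r t)
fold l r (right t) = r (fold l r t)

unravel-cover : ∀ {A} (l r : A → A) → BoundedCover (unravel A) (functionFrame A l r)
unravel-cover l r w = folding , leaf w , refl
  where
  folding : BoundedMorphism (unravel _) (functionFrame _ l r)
  map   folding                    = fold l r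
  forth folding (branch t)         = refl , refl
  back  folding {w = t} (x≡ , y≡) = left t , right t , sym x≡ , sym y≡ , branch t

emptyFrame : Set → Frame3
emptyFrame A = record { W = A ; B = λ _ _ _ → ⊥ }

emptyFrame-⊤-cover : ∀ {A} → BoundedCover (emptyFrame ⊤) (emptyFrame A)
emptyFrame-⊤-cover w = record { map = const w ; forth = λ () ; back = λ () } , tt , refl

emptyFrame-⊤-B6 : B6 (emptyFrame ⊤)
emptyFrame-⊤-B6 _ _ _ (x≢y , _) = ⊥-elim (x≢y refl)

coneFrame : Set → Frame3
coneFrame A = record { W = Maybe A ; B = λ x y z → y ≡ nothing × x ≢ z }

coneFrame-B8 : ∀ A → B8 (coneFrame A)
coneFrame-B8 A x z x≢z = nothing , refl , x≢z

emptyFrame-embedding : ∀ A → GeneratedEmbedding (emptyFrame A) (coneFrame A)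
map   (morphism (emptyFrame-embedding A)) = just
forth (morphism (emptyFrame-embedding A)) ()
back  (morphism (emptyFrame-embedding A)) (() , _)
injective (emptyFrame-embedding A)        = just-injective

¬B1 : ¬ B1 (functionFrame ℕ id id)
¬B1 b1 = proj₁ (b1 0 0 0 (refl , refl)) refl

¬B3 : ¬ B3 (functionFrame ℕ id id)
¬B3 b3 = b3 0 0 0 (refl , refl) (refl , refl)

¬B4 : ¬ B4 (functionFrame ℕ pred suc)
¬B4 b4 with b4 0 1 2 3 (refl , refl) (refl , refl)
... | _ , ()

¬B5 : ¬ B5 (functionFrame ℕ id suc)
¬B5 b5 with b5 0 0 1 0 (refl , refl) (refl , refl)
... | _ , ()

¬B6 : ¬ B6 (emptyFrame ℕ)
¬B6 b6 with b6 0 1 2 ((λ ()) , (λ ()) , (λ ()))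
... | inj₁ ()
... | inj₂ (inj₁ ())
... | inj₂ (inj₂ ())

¬B8 : ¬ B8 (emptyFrame ℕ)
¬B8 b8 with b8 0 1 (λ ())
... | _ , ()

theorem4p15 : ¬ Definableβ B1 × ¬ Definableβ B3 × ¬ Definableβ B4 × ¬ Definableβ B5 × ¬ Definableβ B6 × ¬ DefinableH B8
theorem4p15 =
  ¬Definableβ-cover (unravel-B1 ℕ) ¬B1 (unravel-cover id id) ,
  ¬Definableβ-cover (unravel-B3 ℕ) ¬B3 (unravel-cover id id) ,
  ¬Definableβ-cover (unravel-B4 ℕ) ¬B4 (unravel-cover pred suc) ,
  ¬Definableβ-cover (unravel-B5 ℕ) ¬B5 (unravel-cover id suc) ,
  ¬Definableβ-cover emptyFrame-⊤-B6 ¬B6 emptyFrame-⊤-cover ,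
  ¬DefinableH-embedding (coneFrame-B8 ℕ) ¬B8 (emptyFrame-embedding ℕ)
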